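{- Let $(x_1,\dots,x_5)\in\mathbb{Z}^5$ satisfy $x_{i+2}^2-2x_{i+1}^2+x_i^2=2$ for $i=1,2,3$. Then, after replacing some of $x_1,x_3,x_5$ by their negatives if necessary, the triples $(x_1,x_2,x_3)$ and $(x_3,x_4,x_5)$ both lie in the $H$-orbit of $(-1,0,1)$ if $x_1$ is odd, and both lie in the $H$-orbit of $(2,1,0)$ if $x_1$ is even.
   Context: $B=\begin{pmatrix}3&4&0\\2&3&0\\0&0&1\end{pmatrix}$, $J=\begin{pmatrix}0&0&1\\0&1&0\\1&0&0\end{pmatrix}$, and $H$ is the subgroup of $\mathrm{GL}_3(\mathbb{Z})$ generated by $B$ and $J$, acting on column vectors by left multiplication; the $H$-orbit of $v$ is $\{Mv: M\in H\}$. -}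

module Defs where

open import Data.Integer using (ℤ; +_; -_; _+_; _*_; _-_)
open import Data.Product using (Σ; _×_; _,_)
open import Relation.Binary.PropositionalEquality using (_≡_)

record Mat3 : Set where
  constructor mat
  field
    a11 a12 a13 a21 a22 a23 a31 a32 a33 : ℤ

record Vec3 : Set where
  constructor vec
  field
    v1 v2 v3 : ℤ

open Mat3
open Vec3

_⊗_ : Mat3 → Mat3 → Mat3
M ⊗ N = mat
  (a11 M * a11 N + a12 M * a21 N + a13 M * a31 N)
  (a11 M * a12 N + a12 M * a22 N + a13 M * a32 N)
  (a11 M * a13 N + a12 M * a23 N + a13 M * a33 N)
  (a21 M * a11 N + a22 M * a21 N + a23 M * a31 N)
  (a21 M * a12 N + a22 M * a22 N + a23 M * a32 N)
  (a21 M * a13 N + a22 M * a23 N + a23 M * a33 N)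
  (a31 M * a11 N + a32 M * a21 N + a33 M * a31 N)
  (a31 M * a12 N + a32 M * a22 N + a33 M * a32 N)
  (a31 M * a13 N + a32 M * a23 N + a33 M * a33 N)

_·_ : Mat3 → Vec3 → Vec3
M · v = vec
  (a11 M * v1 v + a12 M * v2 v + a13 M * v3 v)
  (a21 M * v1 v + a22 M * v2 v + a23 M * v3 v)
  (a31 M * v1 v + a32 M * v2 v + a33 M * v3 v)

I₃ : Mat3
I₃ = mat (+ 1) (+ 0) (+ 0) (+ 0) (+ 1) (+ 0) (+ 0) (+ 0) (+ 1)

B : Mat3
B = mat (+ 3) (+ 4) (+ 0) (+ 2) (+ 3) (+ 0) (+ 0) (+ 0) (+ 1)

B⁻¹ : Mat3
B⁻¹ = mat (+ 3) (- (+ 4)) (+ 0) (- (+ 2)) (+ 3) (+ 0) (+ 0) (+ 0) (+ 1)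

J : Mat3
J = mat (+ 0) (+ 0) (+ 1) (+ 0) (+ 1) (+ 0) (+ 1) (+ 0) (+ 0)

-- H = subgroup of GL₃(ℤ) generated by B and J:
-- all finite words in B, B⁻¹, J (J⁻¹ = J), including the empty word I₃.
data InH : Mat3 → Set where
  h-id : InH I₃
  h-B  : ∀ {M} → InH M → InH (B ⊗ M)
  h-B⁻¹ : ∀ {M} → InH M → InH (B⁻¹ ⊗ M)
  h-J  : ∀ {M} → InH M → InH (J ⊗ M)

InOrbit : Vec3 → Vec3 → Set
InOrbit w v = Σ Mat3 (λ M → InH M × (M · w ≡ v))

data Sign : ℤ → Set where
  plus  : Sign (+ 1)
  minus : Sign (- (+ 1))

module Submission where

-- Each of the two orbits carries a congruence invariant, InvO for
--    (-1, 0, 1) and InvE for (2, 1, 0), preserved by the generators.  A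
--    descent on |b| (apply J to get |c| ≤ |a|, then B or B⁻¹, which shrinks
--    |b| as soon as |b| ≥ 2) connects every solution to one of eight base
--    solutions with |b| ≤ 1; the invariant travels along this path and
--    singles out a base solution in the orbit of the seed.  Hence a solution
--    satisfying InvO (InvE) lies in the orbit of (-1, 0, 1) (of (2, 1, 0)).
--  * Signs.  For a solution (a, b, c), the sign s₃ of c is fixed by c mod 8
--    (middleSign), and some sign s of a makes (s a, b, s₃ c) satisfy the
--    invariant of its parity class.  All conditions involved depend only on
--    a, c mod 16 and b mod 8, so this is an exhaustive check over residues
--    with Q ≡ 2 (mod 32).
--  * Assembly.  Apply the sign choice to (x₁, x₂, x₃) and to (x₅, x₄, x₃),
--    which share the sign of x₃, and conclude with the orbit criteria.

open import Defs
open import Data.Integer using (ℤ; +_; -_; _+_; _*_; _-_)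
open import Data.Integer.Divisibility using (_∣_)
open import Data.Product using (Σ; _×_; _,_)
open import Relation.Nullary using (¬_)
open import Relation.Binary.PropositionalEquality using (_≡_)

open import Data.Integer using (∣_∣; -[1+_]; _⊖_; _%ℕ_; _/ℕ_)
import Data.Integer.Properties as ℤ
import Data.Integer.DivMod as DM
open import Data.Integer.Divisibility.Signed as Signed
  using (∣-refl; ∣m∣n⇒∣m+n; ∣n⇒∣m*n; *-monoʳ-∣; ∣⇒∣ᵤ; ∣ᵤ⇒∣)
  renaming (_∣_ to _∣ₛ_; _∣?_ to _∣ₛ?_)
open import Data.Integer.Tactic.RingSolver using (solve-∀)
open import Data.Nat as ℕ using (ℕ; zero; suc; z≤n; s≤s)
import Data.Nat.Properties as ℕ
import Data.Nat.Tactic.RingSolver as ℕSolver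
open import Data.Nat.Induction using (<-rec)
open import Data.Empty using (⊥; ⊥-elim)
open import Data.Bool using (true; false; if_then_else_)
open import Data.Product using (proj₁; proj₂)
open import Data.Sum using (_⊎_; inj₁; inj₂)
open import Relation.Nullary using (Dec; yes; no; ¬?; _×-dec_; _⊎-dec_; _→-dec_)
open import Relation.Nullary.Decidable using (False; toWitness; toWitnessFalse; decidable-stable)
open import Relation.Binary.PropositionalEquality using (refl; sym; trans; cong; cong₂; subst; module ≡-Reasoning)

moveB moveB⁻¹ moveJ : Vec3 → Vec3
moveB   (vec a b c) = vec (+ 3 * a + + 4 * b) (+ 2 * a + + 3 * b) c
moveB⁻¹ (vec a b c) = vec (+ 3 * a - + 4 * b) (+ 3 * b - + 2 * a) c
moveJ   (vec a b c) = vec c b a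

vec-cong : ∀ {a b c a′ b′ c′} → a ≡ a′ → b ≡ b′ → c ≡ c′ → vec a b c ≡ vec a′ b′ c′
vec-cong refl refl refl = refl

select₁ : ∀ a b c → + 1 * a + + 0 * b + + 0 * c ≡ a
select₁ = solve-∀
select₂ : ∀ a b c → + 0 * a + + 1 * b + + 0 * c ≡ b
select₂ = solve-∀
select₃ : ∀ a b c → + 0 * a + + 0 * b + + 1 * c ≡ c
select₃ = solve-∀

I₃-action : ∀ w → I₃ · w ≡ w
I₃-action (vec a b c) = vec-cong (select₁ a b c) (select₂ a b c) (select₃ a b c)

J-action : ∀ v → J · v ≡ moveJ v
J-action (vec a b c) = vec-cong (select₃ a b c) (select₂ a b c) (select₁ a b c)

B-action : ∀ v → B · v ≡ moveB v
B-action (vec a b c) = vec-cong (row₁ a b c) (row₂ a b c) (select₃ a b c)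
  where
  row₁ : ∀ a b c → + 3 * a + + 4 * b + + 0 * c ≡ + 3 * a + + 4 * b
  row₁ = solve-∀
  row₂ : ∀ a b c → + 2 * a + + 3 * b + + 0 * c ≡ + 2 * a + + 3 * b
  row₂ = solve-∀

B⁻¹-action : ∀ v → B⁻¹ · v ≡ moveB⁻¹ v
B⁻¹-action (vec a b c) = vec-cong (row₁ a b c) (row₂ a b c) (select₃ a b c)
  where
  row₁ : ∀ a b c → + 3 * a + - (+ 4) * b + + 0 * c ≡ + 3 * a - + 4 * b
  row₁ = solve-∀
  row₂ : ∀ a b c → - (+ 2) * a + + 3 * b + + 0 * c ≡ + 3 * b - + 2 * a
  row₂ = solve-∀

moveB-moveB⁻¹ : ∀ v → moveB (moveB⁻¹ v) ≡ v
moveB-moveB⁻¹ (vec a b c) = vec-cong (first a b) (second a b) refl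
  where
  first : ∀ a b → + 3 * (+ 3 * a - + 4 * b) + + 4 * (+ 3 * b - + 2 * a) ≡ a
  first = solve-∀
  second : ∀ a b → + 2 * (+ 3 * a - + 4 * b) + + 3 * (+ 3 * b - + 2 * a) ≡ b
  second = solve-∀

moveB⁻¹-moveB : ∀ v → moveB⁻¹ (moveB v) ≡ v
moveB⁻¹-moveB (vec a b c) = vec-cong (first a b) (second a b) refl
  where
  first : ∀ a b → + 3 * (+ 3 * a + + 4 * b) - + 4 * (+ 2 * a + + 3 * b) ≡ a
  first = solve-∀
  second : ∀ a b → + 3 * (+ 2 * a + + 3 * b) - + 2 * (+ 3 * a + + 4 * b) ≡ b
  second = solve-∀

action-assoc : ∀ M N w → (M ⊗ N) · w ≡ M · (N · w)
action-assoc (mat m₁₁ m₁₂ m₁₃ m₂₁ m₂₂ m₂₃ m₃₁ m₃₂ m₃₃) (mat n₁₁ n₁₂ n₁₃ n₂₁ n₂₂ n₂₃ n₃₁ n₃₂ n₃₃) (vec w₁ w₂ w₃) =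
  vec-cong (row n₁₁ n₁₂ n₁₃ n₂₁ n₂₂ n₂₃ n₃₁ n₃₂ n₃₃ w₁ w₂ w₃ m₁₁ m₁₂ m₁₃)
           (row n₁₁ n₁₂ n₁₃ n₂₁ n₂₂ n₂₃ n₃₁ n₃₂ n₃₃ w₁ w₂ w₃ m₂₁ m₂₂ m₂₃)
           (row n₁₁ n₁₂ n₁₃ n₂₁ n₂₂ n₂₃ n₃₁ n₃₂ n₃₃ w₁ w₂ w₃ m₃₁ m₃₂ m₃₃)
  where
  row : ∀ n₁₁ n₁₂ n₁₃ n₂₁ n₂₂ n₂₃ n₃₁ n₃₂ n₃₃ w₁ w₂ w₃ x₁ x₂ x₃ →
    (x₁ * n₁₁ + x₂ * n₂₁ + x₃ * n₃₁) * w₁ + (x₁ * n₁₂ + x₂ * n₂₂ + x₃ * n₃₂) * w₂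
      + (x₁ * n₁₃ + x₂ * n₂₃ + x₃ * n₃₃) * w₃
    ≡ x₁ * (n₁₁ * w₁ + n₁₂ * w₂ + n₁₃ * w₃) + x₂ * (n₂₁ * w₁ + n₂₂ * w₂ + n₂₃ * w₃)
      + x₃ * (n₃₁ * w₁ + n₃₂ * w₂ + n₃₃ * w₃)
  row = solve-∀

data Reach (w : Vec3) : Vec3 → Set where
  start  : Reach w w
  viaB   : ∀ {v} → Reach w v → Reach w (moveB v)
  viaB⁻¹ : ∀ {v} → Reach w v → Reach w (moveB⁻¹ v)
  viaJ   : ∀ {v} → Reach w v → Reach w (moveJ v)

Reach-trans : ∀ {u v w} → Reach u v → Reach v w → Reach u w
Reach-trans r start      = r
Reach-trans r (viaB s)   = viaB (Reach-trans r s)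
Reach-trans r (viaB⁻¹ s) = viaB⁻¹ (Reach-trans r s)
Reach-trans r (viaJ s)   = viaJ (Reach-trans r s)

orbit-step : ∀ {w v} G {move : Vec3 → Vec3} → (∀ {M} → InH M → InH (G ⊗ M)) →
  (∀ u → G · u ≡ move u) → InOrbit w v → InOrbit w (move v)
orbit-step {w} G closed action (M , h , Mw≡v) =
  G ⊗ M , closed h , trans (action-assoc G M w) (trans (cong (G ·_) Mw≡v) (action _))

Reach⇒InOrbit : ∀ {w v} → Reach w v → InOrbit w v
Reach⇒InOrbit {w} start  = I₃ , h-id , I₃-action w
Reach⇒InOrbit (viaB r)   = orbit-step B h-B B-action (Reach⇒InOrbit r)
Reach⇒InOrbit (viaB⁻¹ r) = orbit-step B⁻¹ h-B⁻¹ B⁻¹-action (Reach⇒InOrbit r)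
Reach⇒InOrbit (viaJ r)   = orbit-step J h-J J-action (Reach⇒InOrbit r)

Q : Vec3 → ℤ
Q (vec a b c) = c * c - + 2 * (b * b) + a * a

Q-moveB : ∀ v → Q (moveB v) ≡ Q v
Q-moveB (vec a b c) = invariant a b c
  where
  invariant : ∀ a b c → c * c - + 2 * ((+ 2 * a + + 3 * b) * (+ 2 * a + + 3 * b))
                          + (+ 3 * a + + 4 * b) * (+ 3 * a + + 4 * b)
                        ≡ c * c - + 2 * (b * b) + a * a
  invariant = solve-∀

Q-moveB⁻¹ : ∀ v → Q (moveB⁻¹ v) ≡ Q v
Q-moveB⁻¹ (vec a b c) = invariant a b c
  where
  invariant : ∀ a b c → c * c - + 2 * ((+ 3 * b - + 2 * a) * (+ 3 * b - + 2 * a))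
                          + (+ 3 * a - + 4 * b) * (+ 3 * a - + 4 * b)
                        ≡ c * c - + 2 * (b * b) + a * a
  invariant = solve-∀

Q-moveJ : ∀ v → Q (moveJ v) ≡ Q v
Q-moveJ (vec a b c) = invariant a b c
  where
  invariant : ∀ a b c → a * a - + 2 * (b * b) + c * c ≡ c * c - + 2 * (b * b) + a * a
  invariant = solve-∀

Q-signs : ∀ {s t} → Sign s → Sign t → ∀ a b c → Q (vec (s * a) b (t * c)) ≡ Q (vec a b c)
Q-signs σ τ a b c = cong₂ (λ x z → z - + 2 * (b * b) + x) (square σ a) (square τ c)
  where
  square : ∀ {s} → Sign s → ∀ x → (s * x) * (s * x) ≡ x * x
  square plus  = solve-∀
  square minus = solve-∀

record Stable (P : Vec3 → Set) : Set where
  field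
    pullB   : ∀ v → P (moveB v) → P v
    pullB⁻¹ : ∀ v → P (moveB⁻¹ v) → P v
    pullJ   : ∀ v → P (moveJ v) → P v

pullback : ∀ {P w v} → Stable P → Reach w v → P v → P w
pullback S start      p = p
pullback S (viaB r)   p = pullback S r (Stable.pullB S _ p)
pullback S (viaB⁻¹ r) p = pullback S r (Stable.pullB⁻¹ S _ p)
pullback S (viaJ r)   p = pullback S r (Stable.pullJ S _ p)

∣-comb₂ : ∀ {d x y z} p q → d ∣ₛ y → d ∣ₛ z → x ≡ p * y + q * z → d ∣ₛ x
∣-comb₂ {d} p q d∣y d∣z x≡ =
  subst (d ∣ₛ_) (sym x≡) (∣m∣n⇒∣m+n (∣n⇒∣m*n p d∣y) (∣n⇒∣m*n q d∣z))

∣-comb₃ : ∀ {d x y z u} p q r → d ∣ₛ y → d ∣ₛ z → d ∣ₛ u → x ≡ p * y + q * z + r * u → d ∣ₛ x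
∣-comb₃ {d} p q r d∣y d∣z d∣u x≡ =
  subst (d ∣ₛ_) (sym x≡) (∣m∣n⇒∣m+n (∣m∣n⇒∣m+n (∣n⇒∣m*n p d∣y) (∣n⇒∣m*n q d∣z)) (∣n⇒∣m*n r d∣u))

2∣4 : + 2 ∣ₛ + 4
2∣4 = Signed.divides (+ 2) refl

InvO : Vec3 → Set
InvO (vec a b c) = (+ 2 ∣ₛ b) × (+ 4 ∣ₛ a + b + c)

InvO-stable : Stable InvO
InvO-stable = record { pullB = pullB ; pullB⁻¹ = pullB⁻¹ ; pullJ = pullJ }
  where
  pullB : ∀ v → InvO (moveB v) → InvO v
  pullB (vec a b c) (2∣b′ , 4∣sum′) = 2∣b , 4∣sum
    where
    middle : ∀ a b → b ≡ + 3 * (+ 2 * a + + 3 * b) + (- (+ 3 * a + + 4 * b)) * + 2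
    middle = solve-∀
    sum : ∀ a b c → a + b + c ≡ + 1 * ((+ 3 * a + + 4 * b) + (+ 2 * a + + 3 * b) + c)
                                  + (- a) * + 4 + (- (+ 3)) * (+ 2 * b)
    sum = solve-∀
    2∣b : + 2 ∣ₛ b
    2∣b = ∣-comb₂ (+ 3) (- (+ 3 * a + + 4 * b)) 2∣b′ ∣-refl (middle a b)
    4∣sum : + 4 ∣ₛ a + b + c
    4∣sum = ∣-comb₃ (+ 1) (- a) (- (+ 3)) 4∣sum′ ∣-refl (*-monoʳ-∣ (+ 2) 2∣b) (sum a b c)
  pullB⁻¹ : ∀ v → InvO (moveB⁻¹ v) → InvO v
  pullB⁻¹ (vec a b c) (2∣b′ , 4∣sum′) = 2∣b , 4∣sum
    where
    middle : ∀ a b → b ≡ + 1 * (+ 3 * b - + 2 * a) + (a - b) * + 2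
    middle = solve-∀
    sum : ∀ a b c → a + b + c ≡ + 1 * ((+ 3 * a - + 4 * b) + (+ 3 * b - + 2 * a) + c) + + 1 * (+ 2 * b)
    sum = solve-∀
    2∣b : + 2 ∣ₛ b
    2∣b = ∣-comb₂ (+ 1) (a - b) 2∣b′ ∣-refl (middle a b)
    4∣sum : + 4 ∣ₛ a + b + c
    4∣sum = ∣-comb₂ (+ 1) (+ 1) 4∣sum′ (*-monoʳ-∣ (+ 2) 2∣b) (sum a b c)
  pullJ : ∀ v → InvO (moveJ v) → InvO v
  pullJ (vec a b c) (2∣b , 4∣sum′) = 2∣b , subst (+ 4 ∣ₛ_) (sum a b c) 4∣sum′
    where
    sum : ∀ a b c → c + b + a ≡ a + b + c
    sum = solve-∀

-- The congruence invariant of the orbit of (2, 1, 0): a is even,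
-- a + c ≡ 2 (mod 4), and n = a + b + c satisfies (n - 1)(n - 3) ≡ 0 (mod 16),
-- i.e. n ≡ 1 or 3 (mod 8).

InvE : Vec3 → Set
InvE (vec a b c) = (+ 2 ∣ₛ a) × (+ 4 ∣ₛ a + c - + 2)
                 × (+ 16 ∣ₛ (a + b + c - + 1) * (a + b + c - + 3))

InvE-stable : Stable InvE
InvE-stable = record { pullB = pullB ; pullB⁻¹ = pullB⁻¹ ; pullJ = pullJ }
  where
  pullB : ∀ v → InvE (moveB v) → InvE v
  pullB (vec a b c) (2∣a′ , 4∣a′c′ , 16∣n′) = 2∣a , 4∣ac , 16∣n
    where
    b′ : ℤ
    b′ = + 2 * a + + 3 * b
    first : ∀ a b → a ≡ + 3 * (+ 3 * a + + 4 * b) + (- (+ 2 * (+ 2 * a + + 3 * b))) * + 2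
    first = solve-∀
    outer : ∀ a b c → a + c - + 2 ≡ + 1 * ((+ 3 * a + + 4 * b) + c - + 2)
                                    + + 1 * (+ 2 * (+ 3 * a + + 4 * b)) + (- (+ 2 * a + + 3 * b)) * + 4
    outer = solve-∀
    product : ∀ a b c → (a + b + c - + 1) * (a + b + c - + 3)
      ≡ + 1 * (((+ 3 * a + + 4 * b) + (+ 2 * a + + 3 * b) + c - + 1) * ((+ 3 * a + + 4 * b) + (+ 2 * a + + 3 * b) + c - + 3))
        + (- (+ 2 * a + + 3 * b)) * (+ 4 * ((+ 3 * a + + 4 * b) + c - + 2))
    product = solve-∀
    2∣a : + 2 ∣ₛ a
    2∣a = ∣-comb₂ (+ 3) (- (+ 2 * b′)) 2∣a′ ∣-refl (first a b)
    4∣ac : + 4 ∣ₛ a + c - + 2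
    4∣ac = ∣-comb₃ (+ 1) (+ 1) (- b′) 4∣a′c′ (*-monoʳ-∣ (+ 2) 2∣a′) ∣-refl (outer a b c)
    16∣n : + 16 ∣ₛ (a + b + c - + 1) * (a + b + c - + 3)
    16∣n = ∣-comb₂ (+ 1) (- b′) 16∣n′ (*-monoʳ-∣ (+ 4) 4∣a′c′) (product a b c)
  pullB⁻¹ : ∀ v → InvE (moveB⁻¹ v) → InvE v
  pullB⁻¹ (vec a b c) (2∣a′ , 4∣a′c′ , 16∣n′) = 2∣a , 4∣ac , 16∣n
    where
    first : ∀ a b → a ≡ + 3 * (+ 3 * a - + 4 * b) + (+ 2 * (+ 3 * b - + 2 * a)) * + 2
    first = solve-∀
    outer : ∀ a b c → a + c - + 2 ≡ + 1 * ((+ 3 * a - + 4 * b) + c - + 2)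
                                    + + 1 * (+ 2 * (+ 3 * a - + 4 * b)) + (+ 3 * b - + 2 * a) * + 4
    outer = solve-∀
    product : ∀ a b c → (a + b + c - + 1) * (a + b + c - + 3)
      ≡ + 1 * (((+ 3 * a - + 4 * b) + (+ 3 * b - + 2 * a) + c - + 1) * ((+ 3 * a - + 4 * b) + (+ 3 * b - + 2 * a) + c - + 3))
        + b * (+ 4 * (a + c - + 2))
    product = solve-∀
    2∣a : + 2 ∣ₛ a
    2∣a = ∣-comb₂ (+ 3) (+ 2 * (+ 3 * b - + 2 * a)) 2∣a′ ∣-refl (first a b)
    4∣ac : + 4 ∣ₛ a + c - + 2
    4∣ac = ∣-comb₃ (+ 1) (+ 1) (+ 3 * b - + 2 * a) 4∣a′c′ (*-monoʳ-∣ (+ 2) 2∣a′) ∣-refl (outer a b c)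
    16∣n : + 16 ∣ₛ (a + b + c - + 1) * (a + b + c - + 3)
    16∣n = ∣-comb₂ (+ 1) b 16∣n′ (*-monoʳ-∣ (+ 4) 4∣ac) (product a b c)
  pullJ : ∀ v → InvE (moveJ v) → InvE v
  pullJ (vec a b c) (2∣c , 4∣ca , 16∣n′) =
    ∣-comb₃ (+ 1) (- (+ 1)) (+ 1) (Signed.∣-trans 2∣4 4∣ca) 2∣c ∣-refl (first a c) ,
    subst (+ 4 ∣ₛ_) (outer a c) 4∣ca ,
    subst (+ 16 ∣ₛ_) (product a b c) 16∣n′
    where
    first : ∀ a c → a ≡ + 1 * (c + a - + 2) + (- (+ 1)) * c + + 1 * + 2
    first = solve-∀
    outer : ∀ a c → c + a - + 2 ≡ a + c - + 2
    outer = solve-∀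
    product : ∀ a b c → (c + b + a - + 1) * (c + b + a - + 3) ≡ (a + b + c - + 1) * (a + b + c - + 3)
    product = solve-∀

square-abs : ∀ x → x * x ≡ + (∣ x ∣ ℕ.* ∣ x ∣)
square-abs (+ n)    = sym (ℤ.pos-* n n)
square-abs -[1+ n ] = refl

Q-abs : ∀ a b c {β} → ∣ b ∣ ≡ β → Q (vec a b c) ≡ + 2 →
  ∣ a ∣ ℕ.* ∣ a ∣ ℕ.+ ∣ c ∣ ℕ.* ∣ c ∣ ≡ 2 ℕ.+ 2 ℕ.* (β ℕ.* β)
Q-abs a b c refl q = ℤ.+-injective (begin
  + (∣ a ∣ ℕ.* ∣ a ∣) + + (∣ c ∣ ℕ.* ∣ c ∣) ≡⟨ cong₂ _+_ (square-abs a) (square-abs c) ⟨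
  a * a + c * c                            ≡⟨ rearrange a b c ⟩
  Q (vec a b c) + + 2 * (b * b)            ≡⟨ cong₂ (λ x y → x + + 2 * y) q (square-abs b) ⟩
  + 2 + + 2 * + (∣ b ∣ ℕ.* ∣ b ∣)           ≡⟨ cong (λ x → + 2 + x) (ℤ.pos-* 2 (∣ b ∣ ℕ.* ∣ b ∣)) ⟨
  + (2 ℕ.+ 2 ℕ.* (∣ b ∣ ℕ.* ∣ b ∣))         ∎)
  where
  open ≡-Reasoning
  rearrange : ∀ a b c → a * a + c * c ≡ (c * c - + 2 * (b * b) + a * a) + + 2 * (b * b)
  rearrange = solve-∀

square≤sum : ∀ {k α} γ → k ℕ.≤ α → k ℕ.* k ℕ.≤ α ℕ.* α ℕ.+ γ ℕ.* γ
square≤sum {α = α} γ k≤α = ℕ.≤-trans (ℕ.*-mono-≤ k≤α k≤α) (ℕ.m≤m+n (α ℕ.* α) (γ ℕ.* γ))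

unit-solution : ∀ α γ → γ ℕ.≤ α → α ℕ.* α ℕ.+ γ ℕ.* γ ≡ 2 → α ≡ 1 × γ ≡ 1
unit-solution 0 0 _ ()
unit-solution 1 0 _ ()
unit-solution 1 1 _ _ = refl , refl
unit-solution 1 (suc (suc _)) (s≤s ()) _
unit-solution (suc (suc α)) γ _ eq with subst (4 ℕ.≤_) eq (square≤sum {2} γ (s≤s (s≤s z≤n)))
... | s≤s (s≤s ())

two-solution : ∀ α γ → γ ℕ.≤ α → α ℕ.* α ℕ.+ γ ℕ.* γ ≡ 4 → α ≡ 2 × γ ≡ 0
two-solution 0 0 _ ()
two-solution 1 0 _ ()
two-solution 1 1 _ ()
two-solution 1 (suc (suc _)) (s≤s ()) _
two-solution 2 0 _ _ = refl , refl
two-solution 2 1 _ ()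
two-solution 2 2 _ ()
two-solution 2 (suc (suc (suc _))) (s≤s (s≤s ())) _
two-solution (suc (suc (suc α))) γ _ eq with subst (9 ℕ.≤_) eq (square≤sum {3} γ (s≤s (s≤s (s≤s z≤n))))
... | s≤s (s≤s (s≤s (s≤s ())))

-- Always β < α: otherwise α² + γ² ≤ 2β² < 2 + 2β².
middle<outer : ∀ α β γ → γ ℕ.≤ α → α ℕ.* α ℕ.+ γ ℕ.* γ ≡ 2 ℕ.+ 2 ℕ.* (β ℕ.* β) → β ℕ.< α
middle<outer α β γ γ≤α eq = ℕ.≰⇒> α≰β
  where
  open ℕ.≤-Reasoning
  α≰β : ¬ α ℕ.≤ β
  α≰β α≤β = ℕ.<-irrefl refl (begin-strict
    2 ℕ.* (β ℕ.* β)          <⟨ ℕ.m<n+m _ {2} (s≤s z≤n) ⟩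
    2 ℕ.+ 2 ℕ.* (β ℕ.* β)    ≡⟨ eq ⟨
    α ℕ.* α ℕ.+ γ ℕ.* γ      ≤⟨ ℕ.+-mono-≤ α²≤β² (ℕ.≤-trans (ℕ.*-mono-≤ γ≤α γ≤α) α²≤β²) ⟩
    β ℕ.* β ℕ.+ β ℕ.* β      ≡⟨ double (β ℕ.* β) ⟩
    2 ℕ.* (β ℕ.* β)          ∎)
    where
    α²≤β² : α ℕ.* α ℕ.≤ β ℕ.* β
    α²≤β² = ℕ.*-mono-≤ α≤β α≤β
    double : ∀ n → n ℕ.+ n ≡ 2 ℕ.* n
    double = ℕSolver.solve-∀

-- For β ≥ 2 also α < 2β: otherwise α² ≥ 4β² > 2 + 2β².
outer<double : ∀ α β γ → 2 ℕ.≤ β → α ℕ.* α ℕ.+ γ ℕ.* γ ≡ 2 ℕ.+ 2 ℕ.* (β ℕ.* β) → α ℕ.< β ℕ.+ β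
outer<double α β γ 2≤β eq = ℕ.≰⇒> 2β≰α
  where
  open ℕ.≤-Reasoning
  2β≰α : ¬ β ℕ.+ β ℕ.≤ α
  2β≰α 2β≤α = ℕ.<-irrefl refl (begin-strict
    2 ℕ.+ 2 ℕ.* (β ℕ.* β)              <⟨ ℕ.+-monoˡ-< (2 ℕ.* (β ℕ.* β)) 2<2β² ⟩
    2 ℕ.* (β ℕ.* β) ℕ.+ 2 ℕ.* (β ℕ.* β) ≡⟨ quadruple β ⟩
    (β ℕ.+ β) ℕ.* (β ℕ.+ β)            ≤⟨ square≤sum γ 2β≤α ⟩
    α ℕ.* α ℕ.+ γ ℕ.* γ                ≡⟨ eq ⟩
    2 ℕ.+ 2 ℕ.* (β ℕ.* β)              ∎)
    where
    2<2β² : 2 ℕ.< 2 ℕ.* (β ℕ.* β)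
    2<2β² = ℕ.<-≤-trans (s≤s (s≤s (s≤s z≤n))) (ℕ.*-monoʳ-≤ 2 (ℕ.*-mono-≤ 2≤β 2≤β))
    quadruple : ∀ n → 2 ℕ.* (n ℕ.* n) ℕ.+ 2 ℕ.* (n ℕ.* n) ≡ (n ℕ.+ n) ℕ.* (n ℕ.+ n)
    quadruple = ℕSolver.solve-∀

three-two-⊖ : ∀ α β → + 3 * + β - + 2 * + α ≡ (3 ℕ.* β) ⊖ (2 ℕ.* α)
three-two-⊖ α β = trans (cong₂ _-_ (sym (ℤ.pos-* 3 β)) (sym (ℤ.pos-* 2 α))) (ℤ.m-n≡m⊖n (3 ℕ.* β) (2 ℕ.* α))

shrinkℕ : ∀ α β → β ℕ.< α → α ℕ.< β ℕ.+ β → ∣ + 3 * + β - + 2 * + α ∣ ℕ.< β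
shrinkℕ α zero _ ()
shrinkℕ α β@(suc _) β<α α<2β rewrite three-two-⊖ α β with 2 ℕ.* α ℕ.≤? 3 ℕ.* β
... | yes 2α≤3β rewrite ℤ.⊖-≥ 2α≤3β =
  ℕ.m<n+o⇒m∸n<o (3 ℕ.* β) (2 ℕ.* α) (subst (ℕ._< 2 ℕ.* α ℕ.+ β) (triple β) (ℕ.+-monoˡ-< β (ℕ.*-monoʳ-< 2 β<α)))
  where
  triple : ∀ n → 2 ℕ.* n ℕ.+ n ≡ 3 ℕ.* n
  triple = ℕSolver.solve-∀
... | no 2α≰3β rewrite ℤ.⊖-< (ℕ.≰⇒> 2α≰3β) | ℤ.∣-i∣≡∣i∣ (+ (2 ℕ.* α ℕ.∸ 3 ℕ.* β)) =
  ℕ.m<n+o⇒m∸n<o (2 ℕ.* α) (3 ℕ.* β) (subst (2 ℕ.* α ℕ.<_) (quadruple β) (ℕ.*-monoʳ-< 2 α<2β))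
  where
  quadruple : ∀ n → 2 ℕ.* (n ℕ.+ n) ≡ 3 ℕ.* n ℕ.+ n
  quadruple = ℕSolver.solve-∀

abs-neg : ∀ {x y} → x ≡ - y → ∣ x ∣ ≡ ∣ y ∣
abs-neg {y = y} refl = ℤ.∣-i∣≡∣i∣ y

-- In integer terms: whenever |b| < |a| < 2|b|, one of the moves B⁻¹ (middle
-- coordinate 3b - 2a) or B (middle coordinate 2a + 3b) decreases |b|,
-- depending on whether a and b have equal or opposite signs.
shrink : ∀ a b → ∣ b ∣ ℕ.< ∣ a ∣ → ∣ a ∣ ℕ.< ∣ b ∣ ℕ.+ ∣ b ∣ →
  ∣ + 3 * b - + 2 * a ∣ ℕ.< ∣ b ∣ ⊎ ∣ + 2 * a + + 3 * b ∣ ℕ.< ∣ b ∣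
shrink (+ α) (+ β) β<α α<2β = inj₁ (shrinkℕ α β β<α α<2β)
shrink -[1+ α ] -[1+ β ] β<α α<2β =
  inj₁ (subst (ℕ._< suc β) (sym (abs-neg (negate-both (+ suc α) (+ suc β)))) (shrinkℕ (suc α) (suc β) β<α α<2β))
  where
  negate-both : ∀ A B → + 3 * (- B) - + 2 * (- A) ≡ - (+ 3 * B - + 2 * A)
  negate-both = solve-∀
shrink (+ α) -[1+ β ] β<α α<2β =
  inj₂ (subst (ℕ._< suc β) (sym (abs-neg (negate-middle (+ α) (+ suc β)))) (shrinkℕ α (suc β) β<α α<2β))
  where
  negate-middle : ∀ A B → + 2 * A + + 3 * (- B) ≡ - (+ 3 * B - + 2 * A)
  negate-middle = solve-∀
shrink -[1+ α ] (+ β) β<α α<2β =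
  inj₂ (subst (ℕ._< β) (cong ∣_∣ (negate-outer (+ suc α) (+ β))) (shrinkℕ (suc α) β β<α α<2β))
  where
  negate-outer : ∀ A B → + 3 * B - + 2 * A ≡ + 2 * (- A) + + 3 * B
  negate-outer = solve-∀

-- The descent.  Base solutions are those with |b| ≤ 1 and |c| ≤ |a|, namely
-- (±1, 0, ±1) and (±2, ±1, 0); every solution is reachable from one of them.

data Base : Vec3 → Set where
  unit-base : ∀ {s t} → Sign s → Sign t → Base (vec (s * + 1) (+ 0) (t * + 1))
  two-base  : ∀ {s t} → Sign s → Sign t → Base (vec (s * + 2) (t * + 1) (+ 0))

Descends : Vec3 → Set
Descends v = Σ Vec3 λ β → Base β × Reach β v

at-base : ∀ {β v} → Base β → β ≡ v → Descends v
at-base {β} base β≡v = β , base , subst (Reach β) β≡v start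

Descends-unB : ∀ v → Descends (moveB v) → Descends v
Descends-unB v (β , base , r) = β , base , subst (Reach β) (moveB⁻¹-moveB v) (viaB⁻¹ r)

Descends-unB⁻¹ : ∀ v → Descends (moveB⁻¹ v) → Descends v
Descends-unB⁻¹ v (β , base , r) = β , base , subst (Reach β) (moveB-moveB⁻¹ v) (viaB r)

sign-abs : ∀ a {n} → ∣ a ∣ ≡ n → Σ ℤ λ s → Sign s × s * + n ≡ a
sign-abs (+ n)    refl = + 1 , plus , ℤ.*-identityˡ (+ n)
sign-abs -[1+ n ] refl = - + 1 , minus , ℤ.-1*i≡-i (+ suc n)

DescentAt : ℕ → Set
DescentAt n = ∀ a b c → ∣ b ∣ ≡ n → Q (vec a b c) ≡ + 2 → Descends (vec a b c)

descent-ordered : ∀ n → (∀ {m} → m ℕ.< n → DescentAt m) →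
  ∀ a b c → ∣ c ∣ ℕ.≤ ∣ a ∣ → ∣ b ∣ ≡ n → Q (vec a b c) ≡ + 2 → Descends (vec a b c)
descent-ordered zero _ a b c c≤a b≡0 q
  with unit-solution (∣ a ∣) (∣ c ∣) c≤a (Q-abs a b c b≡0 q)
... | a≡1 , c≡1 with sign-abs a a≡1 | sign-abs c c≡1
... | s , σ , sa≡a | t , τ , tc≡c =
  at-base (unit-base σ τ) (vec-cong sa≡a (sym (ℤ.∣i∣≡0⇒i≡0 b≡0)) tc≡c)
descent-ordered (suc zero) _ a b c c≤a b≡1 q
  with two-solution (∣ a ∣) (∣ c ∣) c≤a (Q-abs a b c b≡1 q)
... | a≡2 , c≡0 with sign-abs a a≡2 | sign-abs b b≡1
... | s , σ , sa≡a | t , τ , tb≡b =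
  at-base (two-base σ τ) (vec-cong sa≡a tb≡b (sym (ℤ.∣i∣≡0⇒i≡0 c≡0)))
descent-ordered (suc (suc m)) rec a b c c≤a b≡n q
  with shrink a b (middle<outer (∣ a ∣) (∣ b ∣) (∣ c ∣) c≤a (Q-abs a b c refl q))
                  (outer<double (∣ a ∣) (∣ b ∣) (∣ c ∣) 2≤b (Q-abs a b c refl q))
  where
  2≤b : 2 ℕ.≤ ∣ b ∣
  2≤b = subst (2 ℕ.≤_) (sym b≡n) (s≤s (s≤s z≤n))
... | inj₁ lt = Descends-unB⁻¹ (vec a b c)
  (rec (ℕ.<-≤-trans lt (ℕ.≤-reflexive b≡n)) (+ 3 * a - + 4 * b) (+ 3 * b - + 2 * a) c refl
       (trans (Q-moveB⁻¹ (vec a b c)) q))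
... | inj₂ lt = Descends-unB (vec a b c)
  (rec (ℕ.<-≤-trans lt (ℕ.≤-reflexive b≡n)) (+ 3 * a + + 4 * b) (+ 2 * a + + 3 * b) c refl
       (trans (Q-moveB (vec a b c)) q))

descent : ∀ v → Q v ≡ + 2 → Descends v
descent (vec a b c) q = <-rec DescentAt step (∣ b ∣) a b c refl q
  where
  step : ∀ n → (∀ {m} → m ℕ.< n → DescentAt m) → DescentAt n
  step n rec a b c b≡n q with ∣ c ∣ ℕ.≤? ∣ a ∣
  ... | yes c≤a = descent-ordered n rec a b c c≤a b≡n q
  ... | no c≰a with descent-ordered n rec c b a (ℕ.≰⇒≥ c≰a) b≡n (trans (Q-moveJ (vec a b c)) q)
  ... | β , base , r = β , base , viaJ r

-- The two orbits of the statement are those of the seeds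
-- below; a solution satisfying the invariant of a seed descends to a base
-- solution satisfying it too, and the only such base solutions are the seed
-- itself and one neighbour of it.

odd-seed even-seed : Vec3
odd-seed  = vec (- (+ 1)) (+ 0) (+ 1)
even-seed = vec (+ 2) (+ 1) (+ 0)

refute : ∀ {d x} {_ : False (d ∣ₛ? x)} → d ∣ₛ x → ⊥
refute {_} {_} {no-div} = toWitnessFalse no-div

odd-seed-reaches : ∀ {β} → Base β → InvO β → Reach odd-seed β
odd-seed-reaches (unit-base plus  plus)  (_ , 4∣2)  = ⊥-elim (refute 4∣2)
odd-seed-reaches (unit-base plus  minus) _          = viaJ start
odd-seed-reaches (unit-base minus plus)  _          = start
odd-seed-reaches (unit-base minus minus) (_ , 4∣-2) = ⊥-elim (refute 4∣-2)
odd-seed-reaches (two-base _ plus)       (2∣1 , _)  = ⊥-elim (refute 2∣1)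
odd-seed-reaches (two-base _ minus)      (2∣-1 , _) = ⊥-elim (refute 2∣-1)

even-seed-reaches : ∀ {β} → Base β → InvE β → Reach even-seed β
even-seed-reaches (unit-base plus _)      (2∣1 , _)      = ⊥-elim (refute 2∣1)
even-seed-reaches (unit-base minus _)     (2∣-1 , _)     = ⊥-elim (refute 2∣-1)
even-seed-reaches (two-base plus plus)    _              = start
even-seed-reaches (two-base plus minus)   _              = viaB⁻¹ start
even-seed-reaches (two-base minus plus)   (_ , _ , 16∣8)  = ⊥-elim (refute 16∣8)
even-seed-reaches (two-base minus minus)  (_ , _ , 16∣24) = ⊥-elim (refute 16∣24)

odd-orbit : ∀ v → Q v ≡ + 2 → InvO v → InOrbit odd-seed v
odd-orbit v q inv with descent v q
... | β , base , r =
  Reach⇒InOrbit (Reach-trans (odd-seed-reaches base (pullback InvO-stable r inv)) r)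

even-orbit : ∀ v → Q v ≡ + 2 → InvE v → InOrbit even-seed v
even-orbit v q inv with descent v q
... | β , base , r =
  Reach⇒InOrbit (Reach-trans (even-seed-reaches base (pullback InvE-stable r inv)) r)

SignedInv : ℤ → ℤ → ℤ → ℤ → ℤ → Set
SignedInv s₃ s a b c =
  (¬ (+ 2 ∣ₛ c) → ¬ (+ 2 ∣ₛ a) × InvO (vec (s * a) b (s₃ * c))) ×
  (+ 2 ∣ₛ c → (+ 2 ∣ₛ a) × InvE (vec (s * a) b (s₃ * c)))

InvO? : ∀ v → Dec (InvO v)
InvO? (vec a b c) = (+ 2 ∣ₛ? b) ×-dec (+ 4 ∣ₛ? a + b + c)

InvE? : ∀ v → Dec (InvE v)
InvE? (vec a b c) = (+ 2 ∣ₛ? a) ×-dec (+ 4 ∣ₛ? a + c - + 2)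
                  ×-dec (+ 16 ∣ₛ? (a + b + c - + 1) * (a + b + c - + 3))

SignedInv? : ∀ s₃ s a b c → Dec (SignedInv s₃ s a b c)
SignedInv? s₃ s a b c =
  (¬? (+ 2 ∣ₛ? c) →-dec (¬? (+ 2 ∣ₛ? a) ×-dec InvO? (vec (s * a) b (s₃ * c)))) ×-dec
  ((+ 2 ∣ₛ? c) →-dec ((+ 2 ∣ₛ? a) ×-dec InvE? (vec (s * a) b (s₃ * c))))

SignedInv-resp : ∀ {s₃ s a b c a′ b′ c′} → a ≡ a′ → b ≡ b′ → c ≡ c′ →
  SignedInv s₃ s a b c → SignedInv s₃ s a′ b′ c′
SignedInv-resp refl refl refl h = h

-- The sign of the shared middle entry x₃ depends only on x₃ mod 8: it is -1
-- exactly when x₃ ≡ 6 (mod 8).  It is read off the residue mod 16, the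
-- modulus used below.

residueSign : ℕ → ℤ
residueSign ρ = if ρ ℕ.% 8 ℕ.≡ᵇ 6 then - + 1 else + 1

residueSign-sign : ∀ ρ → Sign (residueSign ρ)
residueSign-sign ρ with ρ ℕ.% 8 ℕ.≡ᵇ 6
... | true  = minus
... | false = plus

middleSign : ℤ → ℤ
middleSign c = residueSign (c %ℕ 16)

ResidueClaim : ℕ → ℕ → ℕ → Set
ResidueClaim ρa ρb ρc = + 32 ∣ₛ Q (vec (+ ρa) (+ ρb) (+ ρc)) - + 2 →
  SignedInv (residueSign ρc) (+ 1) (+ ρa) (+ ρb) (+ ρc) ⊎
  SignedInv (residueSign ρc) (- + 1) (+ ρa) (+ ρb) (+ ρc)

ResidueClaim? : ∀ ρa ρb ρc → Dec (ResidueClaim ρa ρb ρc)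
ResidueClaim? ρa ρb ρc = (+ 32 ∣ₛ? Q (vec (+ ρa) (+ ρb) (+ ρc)) - + 2) →-dec
  (SignedInv? (residueSign ρc) (+ 1) (+ ρa) (+ ρb) (+ ρc) ⊎-dec
   SignedInv? (residueSign ρc) (- + 1) (+ ρa) (+ ρb) (+ ρc))

-- Kept opaque: the decision procedure is run once here and never unfolded
-- again when residue-check is used.
opaque
  residue-check : ∀ {ρa} → ρa ℕ.< 16 → ∀ {ρb} → ρb ℕ.< 8 → ∀ {ρc} → ρc ℕ.< 16 → ResidueClaim ρa ρb ρc
  residue-check = toWitness {a? = ℕ.allUpTo? (λ ρa → ℕ.allUpTo? (λ ρb → ℕ.allUpTo? (ResidueClaim? ρa ρb) 16) 8) 16} _

parity-shift : ∀ x q → + 2 ∣ₛ x → + 2 ∣ₛ x + q * + 16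
parity-shift x q 2∣x = ∣-comb₂ (+ 1) (q * + 8) 2∣x ∣-refl (split x q)
  where
  split : ∀ x q → x + q * + 16 ≡ + 1 * x + (q * + 8) * + 2
  split = solve-∀

parity-unshift : ∀ x q → + 2 ∣ₛ x + q * + 16 → + 2 ∣ₛ x
parity-unshift x q 2∣x′ = ∣-comb₂ (+ 1) (- (q * + 8)) 2∣x′ ∣-refl (split x q)
  where
  split : ∀ x q → x ≡ + 1 * (x + q * + 16) + (- (q * + 8)) * + 2
  split = solve-∀

InvO-periodic : ∀ a b c qa qb qc → InvO (vec a b c) →
  InvO (vec (a + qa * + 16) (b + qb * + 8) (c + qc * + 16))
InvO-periodic a b c qa qb qc (2∣b , 4∣sum) =
  ∣-comb₂ (+ 1) (qb * + 4) 2∣b ∣-refl (middle b qb) ,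
  ∣-comb₂ (+ 1) (qa * + 4 + qb * + 2 + qc * + 4) 4∣sum ∣-refl (sum a b c qa qb qc)
  where
  middle : ∀ b qb → b + qb * + 8 ≡ + 1 * b + (qb * + 4) * + 2
  middle = solve-∀
  sum : ∀ a b c qa qb qc → (a + qa * + 16) + (b + qb * + 8) + (c + qc * + 16)
                         ≡ + 1 * (a + b + c) + (qa * + 4 + qb * + 2 + qc * + 4) * + 4
  sum = solve-∀

InvE-periodic : ∀ a b c qa qb qc → InvE (vec a b c) →
  InvE (vec (a + qa * + 16) (b + qb * + 8) (c + qc * + 16))
InvE-periodic a b c qa qb qc (2∣a , 4∣ac , 16∣n) =
  parity-shift a qa 2∣a ,
  ∣-comb₂ (+ 1) (qa * + 4 + qc * + 4) 4∣ac ∣-refl (outer a c qa qc) ,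
  ∣-comb₂ (+ 1) (k * (n - + 2) + + 4 * k * k) 16∣n ∣-refl
    (trans (cong (λ m → (m - + 1) * (m - + 3)) (shifted a b c qa qb qc)) (expand n k))
  where
  n k : ℤ
  n = a + b + c
  k = + 2 * qa + qb + + 2 * qc
  outer : ∀ a c qa qc → (a + qa * + 16) + (c + qc * + 16) - + 2
                      ≡ + 1 * (a + c - + 2) + (qa * + 4 + qc * + 4) * + 4
  outer = solve-∀
  shifted : ∀ a b c qa qb qc → (a + qa * + 16) + (b + qb * + 8) + (c + qc * + 16)
                             ≡ (a + b + c) + (+ 2 * qa + qb + + 2 * qc) * + 8
  shifted = solve-∀
  expand : ∀ n k → (n + k * + 8 - + 1) * (n + k * + 8 - + 3)
                 ≡ + 1 * ((n - + 1) * (n - + 3)) + (k * (n - + 2) + + 4 * k * k) * + 16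
  expand = solve-∀

scaled-shift : ∀ s x q m → s * (x + q * m) ≡ s * x + (s * q) * m
scaled-shift = solve-∀

SignedInv-periodic : ∀ s₃ s a b c qa qb qc → SignedInv s₃ s a b c →
  SignedInv s₃ s (a + qa * + 16) (b + qb * + 8) (c + qc * + 16)
SignedInv-periodic s₃ s a b c qa qb qc (odd , even) = odd′ , even′
  where
  signed : ∀ {P : Vec3 → Set} →
    P (vec (s * a + (s * qa) * + 16) (b + qb * + 8) (s₃ * c + (s₃ * qc) * + 16)) →
    P (vec (s * (a + qa * + 16)) (b + qb * + 8) (s₃ * (c + qc * + 16)))
  signed {P} = subst P (sym (vec-cong (scaled-shift s a qa (+ 16)) refl (scaled-shift s₃ c qc (+ 16))))
  odd′ : ¬ (+ 2 ∣ₛ c + qc * + 16) → ¬ (+ 2 ∣ₛ a + qa * + 16) × InvO (vec (s * (a + qa * + 16)) (b + qb * + 8) (s₃ * (c + qc * + 16)))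
  odd′ c′-odd with odd (λ 2∣c → c′-odd (parity-shift c qc 2∣c))
  ... | a-odd , inv = (λ 2∣a′ → a-odd (parity-unshift a qa 2∣a′)) ,
                      signed {InvO} (InvO-periodic (s * a) b (s₃ * c) (s * qa) qb (s₃ * qc) inv)
  even′ : + 2 ∣ₛ c + qc * + 16 → (+ 2 ∣ₛ a + qa * + 16) × InvE (vec (s * (a + qa * + 16)) (b + qb * + 8) (s₃ * (c + qc * + 16)))
  even′ 2∣c′ with even (parity-unshift c qc 2∣c′)
  ... | 2∣a , inv = parity-shift a qa 2∣a ,
                    signed {InvE} (InvE-periodic (s * a) b (s₃ * c) (s * qa) qb (s₃ * qc) inv)

Q-residues : ∀ a b c qa qb qc → Q (vec (a + qa * + 16) (b + qb * + 8) (c + qc * + 16)) ≡ + 2 →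
  + 32 ∣ₛ Q (vec a b c) - + 2
Q-residues a b c qa qb qc q =
  ∣-comb₂ (+ 1) (- e) 32∣Q′-2 ∣-refl (split a b c qa qb qc)
  where
  e : ℤ
  e = qc * c + + 8 * qc * qc - b * qb - + 4 * qb * qb + qa * a + + 8 * qa * qa
  32∣Q′-2 : + 32 ∣ₛ Q (vec (a + qa * + 16) (b + qb * + 8) (c + qc * + 16)) - + 2
  32∣Q′-2 = subst (λ t → + 32 ∣ₛ t - + 2) (sym q) (Signed.divides (+ 0) refl)
  split : ∀ a b c qa qb qc → c * c - + 2 * (b * b) + a * a - + 2 ≡
    + 1 * ((c + qc * + 16) * (c + qc * + 16) - + 2 * ((b + qb * + 8) * (b + qb * + 8))
           + (a + qa * + 16) * (a + qa * + 16) - + 2)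
    + (- (qc * c + + 8 * qc * qc - b * qb - + 4 * qb * qb + qa * a + + 8 * qa * qa)) * + 32
  split = solve-∀

choose-sign : ∀ a b c → Q (vec a b c) ≡ + 2 → Σ ℤ λ s → Sign s × SignedInv (middleSign c) s a b c
choose-sign a b c q =
  pick (residue-check (DM.n%ℕd<d a 16) (DM.n%ℕd<d b 8) (DM.n%ℕd<d c 16)
          (Q-residues (+ ρa) (+ ρb) (+ ρc) (a /ℕ 16) (b /ℕ 8) (c /ℕ 16)
             (subst (λ v → Q v ≡ + 2) (vec-cong a≡ b≡ c≡) q)))
  where
  ρa ρb ρc : ℕ
  ρa = a %ℕ 16
  ρb = b %ℕ 8
  ρc = c %ℕ 16
  a≡ : a ≡ + ρa + (a /ℕ 16) * + 16
  a≡ = DM.a≡a%ℕn+[a/ℕn]*n a 16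
  b≡ : b ≡ + ρb + (b /ℕ 8) * + 8
  b≡ = DM.a≡a%ℕn+[a/ℕn]*n b 8
  c≡ : c ≡ + ρc + (c /ℕ 16) * + 16
  c≡ = DM.a≡a%ℕn+[a/ℕn]*n c 16
  lift : ∀ s → SignedInv (middleSign c) s (+ ρa) (+ ρb) (+ ρc) → SignedInv (middleSign c) s a b c
  lift s h = SignedInv-resp {middleSign c} {s} (sym a≡) (sym b≡) (sym c≡)
    (SignedInv-periodic (middleSign c) s (+ ρa) (+ ρb) (+ ρc) (a /ℕ 16) (b /ℕ 8) (c /ℕ 16) h)
  pick : SignedInv (middleSign c) (+ 1) (+ ρa) (+ ρb) (+ ρc) ⊎ SignedInv (middleSign c) (- + 1) (+ ρa) (+ ρb) (+ ρc) →
    Σ ℤ λ s → Sign s × SignedInv (middleSign c) s a b c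
  pick (inj₁ h) = + 1 , plus , lift (+ 1) h
  pick (inj₂ h) = - + 1 , minus , lift (- + 1) h

OrbitConclusion : (x₁ x₂ x₃ x₄ x₅ s₁ s₃ s₅ : ℤ) → Set
OrbitConclusion x₁ x₂ x₃ x₄ x₅ s₁ s₃ s₅ =
  (¬ (+ 2 ∣ x₁) → InOrbit odd-seed (vec (s₁ * x₁) x₂ (s₃ * x₃)) × InOrbit odd-seed (vec (s₃ * x₃) x₄ (s₅ * x₅))) ×
  (+ 2 ∣ x₁ → InOrbit even-seed (vec (s₁ * x₁) x₂ (s₃ * x₃)) × InOrbit even-seed (vec (s₃ * x₃) x₄ (s₅ * x₅)))

-- The parity of x₁ fixes that of x₃, hence which invariant
-- applies; the second triple is handled reversed and turned back with J.
signed-orbits : ∀ {x₁ x₂ x₃ x₄ x₅ s₁ s₃ s₅} → Sign s₁ → Sign s₃ → Sign s₅ →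
  Q (vec x₁ x₂ x₃) ≡ + 2 → Q (vec x₃ x₄ x₅) ≡ + 2 →
  SignedInv s₃ s₁ x₁ x₂ x₃ → SignedInv s₃ s₅ x₅ x₄ x₃ →
  OrbitConclusion x₁ x₂ x₃ x₄ x₅ s₁ s₃ s₅
signed-orbits {x₁} {x₂} {x₃} {x₄} {x₅} {s₁} {s₃} {s₅} σ₁ σ₃ σ₅ e₁₂₃ e₃₄₅ (odd₁ , even₁) (odd₅ , even₅) =
  (λ x₁-odd → odd-orbit v₁₂₃ q₁₂₃ (proj₂ (odd₁ (x₃-odd x₁-odd))) ,
              odd-orbit v₃₄₅ q₃₄₅ (Stable.pullJ InvO-stable v₃₄₅ (proj₂ (odd₅ (x₃-odd x₁-odd))))) ,
  (λ x₁-even → even-orbit v₁₂₃ q₁₂₃ (proj₂ (even₁ (x₃-even x₁-even))) ,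
               even-orbit v₃₄₅ q₃₄₅ (Stable.pullJ InvE-stable v₃₄₅ (proj₂ (even₅ (x₃-even x₁-even)))))
  where
  v₁₂₃ v₃₄₅ : Vec3
  v₁₂₃ = vec (s₁ * x₁) x₂ (s₃ * x₃)
  v₃₄₅ = vec (s₃ * x₃) x₄ (s₅ * x₅)
  q₁₂₃ : Q v₁₂₃ ≡ + 2
  q₁₂₃ = trans (Q-signs σ₁ σ₃ x₁ x₂ x₃) e₁₂₃
  q₃₄₅ : Q v₃₄₅ ≡ + 2
  q₃₄₅ = trans (Q-signs σ₃ σ₅ x₃ x₄ x₅) e₃₄₅
  x₃-odd : ¬ (+ 2 ∣ x₁) → ¬ (+ 2 ∣ₛ x₃)
  x₃-odd x₁-odd 2∣x₃ = x₁-odd (∣⇒∣ᵤ (proj₁ (even₁ 2∣x₃)))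
  x₃-even : + 2 ∣ x₁ → + 2 ∣ₛ x₃
  x₃-even x₁-even = decidable-stable (+ 2 ∣ₛ? x₃) (λ x₃-odd → proj₁ (odd₁ x₃-odd) (∣ᵤ⇒∣ x₁-even))

-- Main theorem: choose s₃ = middleSign x₃, and s₁, s₅ by choose-sign for the
-- triple (x₁, x₂, x₃) and the reversed triple (x₅, x₄, x₃).
corollary8p4 : (x₁ x₂ x₃ x₄ x₅ : ℤ) →
    x₃ * x₃ - + 2 * (x₂ * x₂) + x₁ * x₁ ≡ + 2 →
    x₄ * x₄ - + 2 * (x₃ * x₃) + x₂ * x₂ ≡ + 2 →
    x₅ * x₅ - + 2 * (x₄ * x₄) + x₃ * x₃ ≡ + 2 →
    Σ ℤ (λ s₁ → Σ ℤ (λ s₃ → Σ ℤ (λ s₅ →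
      Sign s₁ × Sign s₃ × Sign s₅ ×
      ((¬ (+ 2 ∣ x₁) →
          InOrbit (vec (- (+ 1)) (+ 0) (+ 1)) (vec (s₁ * x₁) x₂ (s₃ * x₃))
        × InOrbit (vec (- (+ 1)) (+ 0) (+ 1)) (vec (s₃ * x₃) x₄ (s₅ * x₅)))
      × (+ 2 ∣ x₁ →
          InOrbit (vec (+ 2) (+ 1) (+ 0)) (vec (s₁ * x₁) x₂ (s₃ * x₃))
        × InOrbit (vec (+ 2) (+ 1) (+ 0)) (vec (s₃ * x₃) x₄ (s₅ * x₅)))))))
corollary8p4 x₁ x₂ x₃ x₄ x₅ e₁₂₃ _ e₃₄₅ =
  combine (choose-sign x₁ x₂ x₃ e₁₂₃) (choose-sign x₅ x₄ x₃ (trans (Q-moveJ (vec x₃ x₄ x₅)) e₃₄₅))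
  where
  combine : (Σ ℤ λ s₁ → Sign s₁ × SignedInv (middleSign x₃) s₁ x₁ x₂ x₃) →
            (Σ ℤ λ s₅ → Sign s₅ × SignedInv (middleSign x₃) s₅ x₅ x₄ x₃) →
            Σ ℤ λ s₁ → Σ ℤ λ s₃ → Σ ℤ λ s₅ →
              Sign s₁ × Sign s₃ × Sign s₅ × OrbitConclusion x₁ x₂ x₃ x₄ x₅ s₁ s₃ s₅
  combine (s₁ , σ₁ , inv₁) (s₅ , σ₅ , inv₅) =
    s₁ , middleSign x₃ , s₅ , σ₁ , σ₃ , σ₅ , signed-orbits σ₁ σ₃ σ₅ e₁₂₃ e₃₄₅ inv₁ inv₅
    where
    σ₃ : Sign (middleSign x₃)
    σ₃ = residueSign-sign (x₃ %ℕ 16)
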